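{- Let $k \in \mathbb{N}$ and let $v_1, \ldots, v_s \in \Sigma^+$ be non-empty words. Let $(w_1, \ldots, w_n)$ be any enumeration of the multiset $\bigcup_{i=1}^{s} [v_i]$ (the multiset union of the conjugacy classes of the $v_i$, so $n = \sum_i |v_i|$) such that $\mathrm{context}_k(w_1) \leq \cdots \leq \mathrm{context}_k(w_n)$, and let $L = \mathrm{last}(w_1) \cdots \mathrm{last}(w_n)$. Then for every $i \in \{1, \ldots, n\}$, $$\mathrm{context}_k(w_i) = \lambda_L\bigl(\pi_L(i)\bigr) \cdot \lambda_L\bigl(\pi_L^2(i)\bigr) \cdots \lambda_L\bigl(\pi_L^k(i)\bigr),$$ where $\pi_L^t$ denotes the $t$-fold composition of $\pi_L$.
   Context: $\Sigma$ is a finite non-empty alphabet equipped with a linear order $\leq$; $\Sigma^+$ is the set of non-empty finite words over $\Sigma$. Words are compared by the lexicographic order $\leq$ induced by the order on letters. For a word $w = a_1 \cdots a_n$ with letters $a_i \in \Sigma$: $\lambda_w(i) = a_i$ is the label of position $i$; $\mathrm{last}(w) = a_n$; the right-shift is $r(w) = a_n a_1 \cdots a_{n-1}$ and $r^i$ is its $i$-fold iterate. The conjugacy class of $w$ is the multiset $[w] = \{r^0(w), r^1(w), \ldots, r^{n-1}(w)\}$ (with multiplicity). For $k \in \mathbb{N}$, $\mathrm{context}_k(w)$ is the prefix of length $k$ of the infinite word $w^\omega = www\cdots$ (so it is defined even if $k > |w|$). The standard permutation $\pi_w$ of $\{1, \ldots, n\}$ is defined as follows: order positions by $i \preceq j$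 iff $a_i < a_j$, or $a_i = a_j$ and $i \leq j$; if $j_1 \prec j_2 \prec \cdots \prec j_n$ is the resulting enumeration of $\{1,\ldots,n\}$, then $\pi_w(i) = j_i$. -}

module Defs where

open import Data.Nat using (ℕ; zero; suc)
open import Data.Fin as Fin using (Fin)
open import Data.List as List using (List; []; _∷_; take; concat; replicate; upTo; concatMap)
open import Data.List.NonEmpty as List⁺ using (List⁺; _∷_; toList)
open import Data.Vec as Vec using (Vec; lookup)
open import Data.Product using (_×_; _,_)
open import Data.Sum using (_⊎_)
open import Relation.Binary.PropositionalEquality using (_≡_; _≢_)

module _ {A : Set} (_≤_ : A → A → Set) where

  _<_ : A → A → Set
  a < b = (a ≤ b) × (a ≢ b)

  data _≤lex_ : List A → List A → Set where
    []≤   : ∀ {v} → [] ≤lex v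
    here  : ∀ {a b u v} → a < b → (a ∷ u) ≤lex (b ∷ v)
    there : ∀ {a u v} → u ≤lex v → (a ∷ u) ≤lex (a ∷ v)

  _≺[_]_ : ∀ {n} → Fin n → Vec A n → Fin n → Set
  j ≺[ L ] j' = (lookup L j < lookup L j') ⊎ ((lookup L j ≡ lookup L j') × (j Fin.< j'))

  IsStandardPerm : ∀ {n} → Vec A n → (Fin n → Fin n) → Set
  IsStandardPerm L π =
    (∀ i i' → π i ≡ π i' → i ≡ i') ×
    (∀ j → Σ' j) ×
    (∀ i i' → i Fin.< i' → π i ≺[ L ] π i')
    where
      open import Data.Product using (∃)
      Σ' : _ → Set
      Σ' j = ∃ λ i → π i ≡ j

lastInit : {A : Set} → A → List A → A × List A
lastInit x [] = x , []
lastInit x (y ∷ ys) with lastInit y ys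
... | (l , zs) = l , (x ∷ zs)

-- right shift r(a_1 ... a_n) = a_n a_1 ... a_{n-1}
rshift : {A : Set} → List⁺ A → List⁺ A
rshift (x ∷ xs) with lastInit x xs
... | (l , zs) = l ∷ zs

rpow : {A : Set} → ℕ → List⁺ A → List⁺ A
rpow zero w = w
rpow (suc i) w = rshift (rpow i w)

-- conjugacy class [w] = r^0(w), ..., r^{|w|-1}(w), as a list (multiset)
conj : {A : Set} → List⁺ A → List (List⁺ A)
conj w = List.map (λ i → rpow i w) (upTo (List⁺.length w))

-- context_k(w) = prefix of length k of w^ω (w non-empty, so k copies suffice)
context : {A : Set} → ℕ → List⁺ A → List A
context k w = take k (concat (replicate k (toList w)))

piLabels : {A : Set} {n : ℕ} → Vec A n → (Fin n → Fin n) → ℕ → Fin n → List A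
piLabels L π zero i = []
piLabels L π (suc k) i = lookup L (π i) ∷ piLabels L π k (π i)

-- The right shift permutes every conjugacy class, and context_{k+1}(r w) = last(w) · context_k(w).
-- Hence the list of the words r(w_j), taken in the order j = π(1), π(2), …, has the same multiset
-- of (k+1)-contexts as w_1, …, w_n. It is sorted too: the standard permutation orders positions
-- first by the letter last(w_j) and breaks ties by position, which (by induction on k) is the order
-- of the k-contexts. Two sorted lists with the same multiset of entries coincide, so
-- context_{k+1}(w_i) = last(w_{π(i)}) · context_k(w_{π(i)}), and iterating gives the claim.
module Submission where

open import Defs
open import Data.Nat as ℕ using (ℕ; zero; suc; z≤n; s≤s)
open import Data.Nat.Properties as ℕₚ using (m≤n+m; n≤1+n; m≤n⇒m⊓n≡m)
open import Data.Fin as Fin using (Fin; zero; suc)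
open import Data.List as List
  using (List; []; _∷_; _++_; _∷ʳ_; length; take; concat; replicate; concatMap;
         tabulate; allFin; applyUpTo)
open import Data.List.Properties
  using (∷-injectiveˡ; ∷-injectiveʳ; ∷ʳ-injective; ∷ʳ-injectiveʳ; ++-assoc; ++-identityʳ;
         length-++; take-take; map-tabulate; map-∘; map-++; map-upTo; map-applyUpTo; applyUpTo-∷ʳ)
open import Data.List.NonEmpty as List⁺ using (List⁺; _∷_; last; snocView; _∷ʳ′_)
open import Data.Vec as Vec using (Vec; toList; map; lookup)
open import Data.Vec.Properties using (lookup-map)
open import Data.Product using (Σ-syntax; ∃; ∃₂; _,_; proj₁; proj₂)
open import Data.Sum using (inj₁; inj₂)
open import Data.List.Membership.Propositional using (_∈_)
open import Data.List.Membership.Propositional.Properties using (∈-tabulate⁺; ∈-allFin)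
open import Data.List.Membership.Propositional.Properties.WithK using (unique∧set⇒bag)
open import Data.List.Relation.Binary.BagAndSetEquality using (∼bag⇒↭)
open import Data.List.Relation.Binary.Permutation.Propositional
  using (_↭_; ↭-refl; ↭-sym; ↭-trans; ↭-reflexive; module PermutationReasoning)
open import Data.List.Relation.Binary.Permutation.Propositional.Properties
  using (map⁺; ++⁺; ∷↭∷ʳ; ∈-resp-↭; ↭-length; drop-∷)
open import Data.List.Relation.Unary.Any using (here)
import Data.List.Relation.Unary.All as All
import Data.List.Relation.Unary.All.Properties as All
open import Data.List.Relation.Unary.AllPairs using (AllPairs; _∷_)
import Data.List.Relation.Unary.AllPairs.Properties as AllPairs
open import Data.List.Relation.Unary.Linked as Linked using (Linked)
import Data.List.Relation.Unary.Linked.Properties as Linked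
open import Data.List.Relation.Unary.Unique.Propositional.Properties as Unique using ()
open import Function using (_∘_; id)
open import Function.Bundles using (mk⇔)
open import Function.Definitions using (Injective; StrictlySurjective)
open import Relation.Binary.PropositionalEquality
open import Relation.Binary.Structures using (IsTotalOrder; IsPartialOrder)
open import Relation.Nullary using (contradiction)

module _ {B : Set} where

  toList≡tabulate∘lookup : ∀ {n} (xs : Vec B n) → toList xs ≡ tabulate (lookup xs)
  toList≡tabulate∘lookup Vec.[]       = refl
  toList≡tabulate∘lookup (x Vec.∷ xs) = cong (x ∷_) (toList≡tabulate∘lookup xs)

  tabulate-injective : ∀ {n} {f g : Fin n → B} → tabulate f ≡ tabulate g → f ≗ g
  tabulate-injective eq zero    = ∷-injectiveˡ eq
  tabulate-injective eq (suc i) = tabulate-injective (∷-injectiveʳ eq) i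

  AllPairs-tabulate⁻-< : ∀ {R : B → B → Set} {n} {f : Fin n → B} →
                         AllPairs R (tabulate f) → ∀ {i j} → i Fin.< j → R (f i) (f j)
  AllPairs-tabulate⁻-< (px ∷ _)  {zero}  {suc j} _         = All.tabulate⁻ px j
  AllPairs-tabulate⁻-< (_ ∷ pxs) {suc i} {suc j} (s≤s i<j) = AllPairs-tabulate⁻-< pxs i<j

tabulate-bijection-↭-allFin : ∀ {n} {π : Fin n → Fin n} → Injective _≡_ _≡_ π →
                              StrictlySurjective _≡_ π → tabulate π ↭ allFin n
tabulate-bijection-↭-allFin {n} {π} π-injective π-surjective =
  ∼bag⇒↭ (unique∧set⇒bag (Unique.tabulate⁺ π-injective) (Unique.allFin⁺ n)
    (λ {j} → mk⇔ (λ _ → ∈-allFin j) (λ _ → ∈-image (π-surjective j))))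
  where
    ∈-image : ∀ {j} → ∃ (λ i → π i ≡ j) → j ∈ tabulate π
    ∈-image (i , refl) = ∈-tabulate⁺ i

tabulate-∘-bijection-↭ : ∀ {B : Set} {n} (f : Fin n → B) {π : Fin n → Fin n} →
                         Injective _≡_ _≡_ π → StrictlySurjective _≡_ π →
                         tabulate (f ∘ π) ↭ tabulate f
tabulate-∘-bijection-↭ {n = n} f {π} π-injective π-surjective = begin
  tabulate (f ∘ π)         ≡⟨ map-tabulate π f ⟨
  List.map f (tabulate π)  ↭⟨ map⁺ f (tabulate-bijection-↭-allFin π-injective π-surjective) ⟩
  List.map f (allFin n)    ≡⟨ map-tabulate id f ⟩
  tabulate f               ∎
  where open PermutationReasoning

module _ {B : Set} {R : B → B → Set} (R-isPartialOrder : IsPartialOrder _≡_ R) where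

  open IsPartialOrder R-isPartialOrder using (antisym) renaming (refl to R-refl; trans to R-trans)

  Linked-head-minimum : ∀ {x xs y} → Linked R (x ∷ xs) → y ∈ x ∷ xs → R x y
  Linked-head-minimum x∷xs↗ = All.lookup (Linked.Linked⇒All R-trans R-refl x∷xs↗)

  ↗↭↗⇒≡ : ∀ {xs ys} → Linked R xs → Linked R ys → xs ↭ ys → xs ≡ ys
  ↗↭↗⇒≡ {[]}     {[]}     _   _   _ = refl
  ↗↭↗⇒≡ {[]}     {_ ∷ _}  _   _   p with () ← ↭-length p
  ↗↭↗⇒≡ {_ ∷ _}  {[]}     _   _   p with () ← ↭-length p
  ↗↭↗⇒≡ {x ∷ xs} {y ∷ ys} xs↗ ys↗ p
    with refl ← antisym (Linked-head-minimum xs↗ (∈-resp-↭ (↭-sym p) (here refl)))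
                        (Linked-head-minimum ys↗ (∈-resp-↭ p (here refl)))
    = cong (x ∷_) (↗↭↗⇒≡ (Linked.tail xs↗) (Linked.tail ys↗) (drop-∷ p))

≤lex-take : ∀ {A : Set} {_≤_ : A → A → Set} k {u v} →
            _≤lex_ _≤_ u v → _≤lex_ _≤_ (take k u) (take k v)
≤lex-take zero    _         = []≤
≤lex-take (suc k) []≤       = []≤
≤lex-take (suc k) (here p)  = here p
≤lex-take (suc k) (there p) = there (≤lex-take k p)

module _ {A : Set} {_≤_ : A → A → Set} (≤-isPartialOrder : IsPartialOrder _≡_ _≤_) where

  open IsPartialOrder ≤-isPartialOrder using () renaming (antisym to ≤-antisym; trans to ≤-trans)

  private
    _⊑_ : List A → List A → Set
    _⊑_ = _≤lex_ _≤_

  <-trans : ∀ {a b c} → _<_ _≤_ a b → _<_ _≤_ b c → _<_ _≤_ a c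
  <-trans (a≤b , a≢b) (b≤c , _) = ≤-trans a≤b b≤c , λ { refl → a≢b (≤-antisym a≤b b≤c) }

  ≤lex-refl : ∀ {u} → u ⊑ u
  ≤lex-refl {[]}    = []≤
  ≤lex-refl {_ ∷ _} = there ≤lex-refl

  ≤lex-trans : ∀ {u v w} → u ⊑ v → v ⊑ w → u ⊑ w
  ≤lex-trans []≤       _         = []≤
  ≤lex-trans (here p)  (here q)  = here (<-trans p q)
  ≤lex-trans (here p)  (there _) = here p
  ≤lex-trans (there _) (here q)  = here q
  ≤lex-trans (there p) (there q) = there (≤lex-trans p q)

  ≤lex-antisym : ∀ {u v} → u ⊑ v → v ⊑ u → u ≡ v
  ≤lex-antisym []≤              []≤             = refl
  ≤lex-antisym (here (p , a≢b)) (here (q , _))  = contradiction (≤-antisym p q) a≢b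
  ≤lex-antisym (here (_ , a≢a)) (there _)       = contradiction refl a≢a
  ≤lex-antisym (there _)        (here (_ , a≢a)) = contradiction refl a≢a
  ≤lex-antisym (there p)        (there q)       = cong (_ ∷_) (≤lex-antisym p q)

  ≤lex-isPartialOrder : IsPartialOrder _≡_ _⊑_
  ≤lex-isPartialOrder = record
    { isPreorder = record
      { isEquivalence = isEquivalence
      ; reflexive     = λ { refl → ≤lex-refl }
      ; trans         = ≤lex-trans
      }
    ; antisym = ≤lex-antisym
    }

module _ {A : Set} where

  infixl 8 _^_

  _^_ : List A → ℕ → List A
  c ^ m = concat (replicate m c)

  ^-suc : ∀ (c : List A) m → c ^ suc m ≡ c ^ m ++ c
  ^-suc c zero    = ++-identityʳ c
  ^-suc c (suc m) = trans (cong (c ++_) (^-suc c m)) (sym (++-assoc c (c ^ m) c))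

  ++-^-rotate : ∀ (zs : List A) l k → zs ++ (l ∷ zs) ^ k ≡ (zs ∷ʳ l) ^ k ++ zs
  ++-^-rotate zs l zero    = ++-identityʳ zs
  ++-^-rotate zs l (suc k) = begin
    zs ++ (l ∷ zs) ++ (l ∷ zs) ^ k    ≡⟨ ++-assoc zs (l ∷ []) _ ⟨
    (zs ∷ʳ l) ++ zs ++ (l ∷ zs) ^ k   ≡⟨ cong ((zs ∷ʳ l) ++_) (++-^-rotate zs l k) ⟩
    (zs ∷ʳ l) ++ (zs ∷ʳ l) ^ k ++ zs  ≡⟨ ++-assoc (zs ∷ʳ l) _ zs ⟨
    (zs ∷ʳ l) ^ suc k ++ zs           ∎
    where open ≡-Reasoning

  length-^ : ∀ m (w : List⁺ A) → m ℕ.≤ length (List⁺.toList w ^ m)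
  length-^ zero    _        = z≤n
  length-^ (suc m) (x ∷ xs) = s≤s (ℕₚ.≤-trans (length-^ m (x ∷ xs))
    (subst (length ((x ∷ xs) ^ m) ℕ.≤_) (sym (length-++ xs)) (m≤n+m _ _)))

  take-++-≤ : ∀ k {P Q : List A} → k ℕ.≤ length P → take k (P ++ Q) ≡ take k P
  take-++-≤ zero    {_}     _       = refl
  take-++-≤ (suc k) {_ ∷ _} (s≤s h) = cong (_ ∷_) (take-++-≤ k h)

  context≡take-^ : ∀ k (w : List⁺ A) → context k w ≡ take k (List⁺.toList w ^ k)
  context≡take-^ k (_ ∷ _) = refl

  context-take : ∀ k (w : List⁺ A) → context k w ≡ take k (context (suc k) w)
  context-take k w = begin
    context k w                         ≡⟨ context≡take-^ k w ⟩
    take k (c ^ k)                      ≡⟨ take-++-≤ k (length-^ k w) ⟨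
    take k (c ^ k ++ c)                 ≡⟨ cong (take k) (^-suc c k) ⟨
    take k (c ^ suc k)                  ≡⟨ cong (λ t → take t (c ^ suc k)) (m≤n⇒m⊓n≡m (n≤1+n k)) ⟨
    take (k ℕ.⊓ suc k) (c ^ suc k)      ≡⟨ take-take k (suc k) _ ⟨
    take k (take (suc k) (c ^ suc k))   ≡⟨ cong (take k) (context≡take-^ (suc k) w) ⟨
    take k (context (suc k) w)          ∎
    where
      open ≡-Reasoning
      c = List⁺.toList w

  toList-injective : ∀ {u v : List⁺ A} → List⁺.toList u ≡ List⁺.toList v → u ≡ v
  toList-injective {_ ∷ _} {_ ∷ _} refl = refl

  lastInit-∷ʳ : ∀ (x : A) xs → x ∷ xs ≡ proj₂ (lastInit x xs) ∷ʳ proj₁ (lastInit x xs)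
  lastInit-∷ʳ x []       = refl
  lastInit-∷ʳ x (y ∷ ys) = cong (x ∷_) (lastInit-∷ʳ y ys)

  toList-unsnoc : ∀ (w : List⁺ A) → ∃₂ λ zs l → List⁺.toList w ≡ zs ∷ʳ l
  toList-unsnoc (x ∷ xs) = _ , _ , lastInit-∷ʳ x xs

  toList-rshift : ∀ (w : List⁺ A) {zs l} → List⁺.toList w ≡ zs ∷ʳ l →
                  List⁺.toList (rshift w) ≡ l ∷ zs
  toList-rshift (x ∷ xs) {zs} w≡
    with zs≡ , l≡ ← ∷ʳ-injective _ zs (trans (sym (lastInit-∷ʳ x xs)) w≡)
    = cong₂ _∷_ l≡ zs≡

  toList-⁺∷ʳ : ∀ (zs : List A) l → List⁺.toList (zs List⁺.∷ʳ l) ≡ zs ∷ʳ l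
  toList-⁺∷ʳ []      _ = refl
  toList-⁺∷ʳ (_ ∷ _) _ = refl

  last-∷ʳ : ∀ (w : List⁺ A) {zs l} → List⁺.toList w ≡ zs ∷ʳ l → last w ≡ l
  last-∷ʳ w {zs} w≡ with snocView w
  ... | ys ∷ʳ′ y = ∷ʳ-injectiveʳ ys zs (trans (sym (toList-⁺∷ʳ ys y)) w≡)

  context-rshift : ∀ k (w : List⁺ A) → context (suc k) (rshift w) ≡ last w ∷ context k w
  context-rshift k w with zs , l , w≡ ← toList-unsnoc w = begin
    context (suc k) (rshift w)
      ≡⟨ context≡take-^ (suc k) (rshift w) ⟩
    take (suc k) (List⁺.toList (rshift w) ^ suc k)
      ≡⟨ cong (λ c → take (suc k) (c ^ suc k)) (toList-rshift w w≡) ⟩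
    l ∷ take k (zs ++ (l ∷ zs) ^ k)
      ≡⟨ cong (λ c → l ∷ take k c) (++-^-rotate zs l k) ⟩
    l ∷ take k ((zs ∷ʳ l) ^ k ++ zs)
      ≡⟨ cong (l ∷_) (take-++-≤ k (subst (λ c → k ℕ.≤ length (c ^ k)) w≡ (length-^ k w))) ⟩
    l ∷ take k ((zs ∷ʳ l) ^ k)
      ≡⟨ cong₂ (λ a c → a ∷ take k (c ^ k)) (last-∷ʳ w w≡) w≡ ⟨
    last w ∷ take k (List⁺.toList w ^ k)
      ≡⟨ cong (last w ∷_) (context≡take-^ k w) ⟨
    last w ∷ context k w
      ∎
    where open ≡-Reasoning

  toList-rpow : ∀ (s p : List A) (w : List⁺ A) → List⁺.toList w ≡ p ++ s →
                List⁺.toList (rpow (length s) w) ≡ s ++ p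
  toList-rpow []      p w w≡ = trans w≡ (++-identityʳ p)
  toList-rpow (a ∷ s) p w w≡ = toList-rshift (rpow (length s) w) (begin
    List⁺.toList (rpow (length s) w)  ≡⟨ toList-rpow s (p ∷ʳ a) w w≡′ ⟩
    s ++ p ∷ʳ a                       ≡⟨ ++-assoc s p (a ∷ []) ⟨
    (s ++ p) ∷ʳ a                     ∎)
    where
      open ≡-Reasoning
      w≡′ : List⁺.toList w ≡ (p ∷ʳ a) ++ s
      w≡′ = trans w≡ (sym (++-assoc p (a ∷ []) s))

  rpow-length : ∀ (w : List⁺ A) → rpow (List⁺.length w) w ≡ w
  rpow-length w =
    toList-injective (trans (toList-rpow (List⁺.toList w) [] w refl) (++-identityʳ _))

  map-rshift-conj-↭ : ∀ (w : List⁺ A) → List.map rshift (conj w) ↭ conj w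
  map-rshift-conj-↭ w@(_ ∷ xs) = begin
    List.map rshift (conj w)
      ≡⟨ cong (List.map rshift) (map-upTo powers (suc m)) ⟩
    List.map rshift (applyUpTo powers (suc m))
      ≡⟨ map-applyUpTo powers rshift (suc m) ⟩
    applyUpTo (powers ∘ suc) (suc m)
      ≡⟨ applyUpTo-∷ʳ (powers ∘ suc) m ⟨
    applyUpTo (powers ∘ suc) m ∷ʳ powers (suc m)
      ≡⟨ cong (applyUpTo (powers ∘ suc) m ∷ʳ_) (rpow-length w) ⟩
    applyUpTo (powers ∘ suc) m ∷ʳ w
      ↭⟨ ∷↭∷ʳ w _ ⟨
    applyUpTo powers (suc m)
      ≡⟨ map-upTo powers (suc m) ⟨
    conj w
      ∎
    where
      open PermutationReasoning
      m = length xs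
      powers : ℕ → List⁺ A
      powers i = rpow i w

  map-rshift-concatMap-conj-↭ : ∀ (vs : List (List⁺ A)) →
                                List.map rshift (concatMap conj vs) ↭ concatMap conj vs
  map-rshift-concatMap-conj-↭ []       = ↭-refl
  map-rshift-concatMap-conj-↭ (v ∷ vs) =
    ↭-trans (↭-reflexive (map-++ rshift (conj v) (concatMap conj vs)))
            (++⁺ (map-rshift-conj-↭ v) (map-rshift-concatMap-conj-↭ vs))

module StandardPermutation
  {A : Set} {_≤_ : A → A → Set} (≤-isPartialOrder : IsPartialOrder _≡_ _≤_)
  {n : ℕ} (ws : Vec (List⁺ A) n) (vs : List (List⁺ A)) (ws↭ : toList ws ↭ concatMap conj vs)
  {π : Fin n → Fin n} (π-standard : IsStandardPerm _≤_ (map last ws) π)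
  where

  private
    _⊑_ : List A → List A → Set
    _⊑_ = _≤lex_ _≤_

    W : Fin n → List⁺ A
    W = lookup ws

    L : Vec A n
    L = map last ws

  π-injective : Injective _≡_ _≡_ π
  π-injective = proj₁ π-standard _ _

  π-surjective : StrictlySurjective _≡_ π
  π-surjective = proj₁ (proj₂ π-standard)

  π-monotone : ∀ {i j} → i Fin.< j → _≺[_]_ _≤_ (π i) L (π j)
  π-monotone = proj₂ (proj₂ π-standard) _ _

  ContextsSorted : ℕ → Set
  ContextsSorted k = ∀ {i j} → i Fin.< j → context k (W i) ⊑ context k (W j)

  Linked⇒ContextsSorted : ∀ k → Linked (λ u v → context k u ⊑ context k v) (toList ws) →
                          ContextsSorted k
  Linked⇒ContextsSorted k ws↗ =
    AllPairs-tabulate⁻-< (Linked.Linked⇒AllPairs (≤lex-trans ≤-isPartialOrder)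
      (subst (Linked _) (toList≡tabulate∘lookup ws) ws↗))

  ContextsSorted-pred : ∀ {k} → ContextsSorted (suc k) → ContextsSorted k
  ContextsSorted-pred {k} sorted {i} {j} i<j =
    subst₂ _⊑_ (sym (context-take k (W i))) (sym (context-take k (W j)))
      (≤lex-take k (sorted i<j))

  lookup-L : ∀ j → lookup L j ≡ last (W j)
  lookup-L j = lookup-map j last ws

  shifted-contexts-sorted : ∀ {k} → ContextsSorted k → ∀ {i j} → i Fin.< j →
                            context (suc k) (rshift (W (π i))) ⊑ context (suc k) (rshift (W (π j)))
  shifted-contexts-sorted {k} sorted {i} {j} i<j =
    subst₂ _⊑_ (sym (context-rshift k (W (π i)))) (sym (context-rshift k (W (π j))))
      (by-last-then-context (π-monotone i<j))
    where
      by-last-then-context : ∀ {a b} → _≺[_]_ _≤_ a L b →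
                             (last (W a) ∷ context k (W a)) ⊑ (last (W b) ∷ context k (W b))
      by-last-then-context {a} {b} (inj₁ La<Lb) =
        here (subst₂ (_<_ _≤_) (lookup-L a) (lookup-L b) La<Lb)
      by-last-then-context {a} {b} (inj₂ (La≡Lb , a<b)) =
        subst (λ l → (last (W a) ∷ _) ⊑ (l ∷ _))
          (trans (sym (lookup-L a)) (trans La≡Lb (lookup-L b))) (there (sorted a<b))

  map-rshift-ws-↭ : List.map rshift (toList ws) ↭ toList ws
  map-rshift-ws-↭ = begin
    List.map rshift (toList ws)            ↭⟨ map⁺ rshift ws↭ ⟩
    List.map rshift (concatMap conj vs)    ↭⟨ map-rshift-concatMap-conj-↭ vs ⟩
    concatMap conj vs                      ↭⟨ ws↭ ⟨
    toList ws                              ∎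
    where open PermutationReasoning

  contexts-↭-shifted-contexts : ∀ m →
    tabulate (context m ∘ W) ↭ tabulate (context m ∘ rshift ∘ W ∘ π)
  contexts-↭-shifted-contexts m = begin
    tabulate (context m ∘ W)
      ≡⟨ map-tabulate W (context m) ⟨
    List.map (context m) (tabulate W)
      ≡⟨ cong (List.map (context m)) (toList≡tabulate∘lookup ws) ⟨
    List.map (context m) (toList ws)
      ↭⟨ map⁺ (context m) map-rshift-ws-↭ ⟨
    List.map (context m) (List.map rshift (toList ws))
      ≡⟨ map-∘ (toList ws) ⟨
    List.map (context m ∘ rshift) (toList ws)
      ≡⟨ cong (List.map (context m ∘ rshift)) (toList≡tabulate∘lookup ws) ⟩
    List.map (context m ∘ rshift) (tabulate W)
      ≡⟨ map-tabulate W (context m ∘ rshift) ⟩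
    tabulate (context m ∘ rshift ∘ W)
      ↭⟨ tabulate-∘-bijection-↭ (context m ∘ rshift ∘ W) π-injective π-surjective ⟨
    tabulate (context m ∘ rshift ∘ W ∘ π)
      ∎
    where open PermutationReasoning

  context-suc : ∀ {k} → ContextsSorted (suc k) →
                ∀ i → context (suc k) (W i) ≡ last (W (π i)) ∷ context k (W (π i))
  context-suc {k} sorted i =
    trans (tabulate-injective contexts≡shifted i) (context-rshift k (W (π i)))
    where
      sorted↗ : ∀ {f : Fin n → List A} → (∀ {i j} → i Fin.< j → f i ⊑ f j) →
                Linked _⊑_ (tabulate f)
      sorted↗ f↗ = Linked.AllPairs⇒Linked (AllPairs.tabulate⁺-< f↗)

      contexts≡shifted : tabulate (context (suc k) ∘ W) ≡
                         tabulate (context (suc k) ∘ rshift ∘ W ∘ π)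
      contexts≡shifted = ↗↭↗⇒≡ (≤lex-isPartialOrder ≤-isPartialOrder)
        (sorted↗ sorted) (sorted↗ (shifted-contexts-sorted (ContextsSorted-pred sorted)))
        (contexts-↭-shifted-contexts (suc k))

  context≡piLabels : ∀ k → ContextsSorted k → ∀ i → context k (W i) ≡ piLabels L π k i
  context≡piLabels zero    _      _ = refl
  context≡piLabels (suc k) sorted i = trans (context-suc sorted i)
    (cong₂ _∷_ (sym (lookup-L (π i))) (context≡piLabels k (ContextsSorted-pred sorted) (π i)))

lemma1 : {A : Set} (_≤_ : A → A → Set) → IsTotalOrder _≡_ _≤_ →
         (Σ[ xs ∈ List A ] (∀ a → a ∈ xs)) → A →
         (k : ℕ) (vs : List (List⁺ A)) (n : ℕ) (ws : Vec (List⁺ A) n) →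
         toList ws ↭ concatMap conj vs →
         Linked (λ u v → _≤lex_ _≤_ (context k u) (context k v)) (toList ws) →
         (π : Fin n → Fin n) → IsStandardPerm _≤_ (map last ws) π →
         (i : Fin n) → context k (lookup ws i) ≡ piLabels (map last ws) π k i
lemma1 _≤_ ≤-isTotalOrder _ _ k vs n ws ws↭ ws↗ π π-standard =
  context≡piLabels k (Linked⇒ContextsSorted k ws↗)
  where open StandardPermutation (IsTotalOrder.isPartialOrder ≤-isTotalOrder) ws vs ws↭ π-standard
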